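{- Let $n\ge 2$ and $m$ be integers with $0\le m\le n(n-1)$, and let $G$ be a directed graph on $n$ labeled vertices chosen uniformly at random among all directed graphs without self-loops or multiple edges that have exactly $m$ edges (i.e., an $m$-subset of the $n(n-1)$ possible ordered pairs chosen uniformly). Then the probability that some vertex of $G$ has degree greater than $8m/n+2\log_2 n$ is less than $2/n$.
   Context: The degree of a vertex is the total number of edges incident to it (in-degree plus out-degree), so it is at most $2(n-1)$. -}

module Defs where

open import Data.Bool using (Bool; true; false; not; _∧_; _∨_; if_then_else_)
open import Data.Nat using (ℕ; zero; suc; _+_; _*_; _∸_; _^_; _<ᵇ_; _≡ᵇ_)
import Data.List
open import Data.List using (List; []; _∷_; concatMap; map)
open import Data.Bool.ListAction using (and; or)
open import Data.Nat.ListAction using (sum)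
open import Data.Vec using (Vec; []; _∷_; lookup)
open import Data.Fin using (Fin)
open import Data.List using () renaming (allFin to allFinL)

allVec : {A : Set} → List A → (k : ℕ) → List (Vec A k)
allVec xs zero = [] ∷ []
allVec xs (suc k) = concatMap (λ x → map (x ∷_) (allVec xs k)) xs

bools : List Bool
bools = false ∷ true ∷ []

-- A directed graph on vertex set Fin n, as an adjacency matrix:
-- A[i][j] = true iff there is an edge (i , j).  Entries are Bool, so no multiple edges.
Adj : ℕ → Set
Adj n = Vec (Vec Bool n) n

allAdj : (n : ℕ) → List (Adj n)
allAdj n = allVec (allVec bools n) n

edge : {n : ℕ} → Adj n → Fin n → Fin n → Bool
edge A i j = lookup (lookup A i) j

countB : {A : Set} → (A → Bool) → List A → ℕ
countB p [] = 0
countB p (x ∷ xs) = (if p x then 1 else 0) + countB p xs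

noLoops : {n : ℕ} → Adj n → Bool
noLoops {n} A = and (map (λ i → not (edge A i i)) (allFinL n))

numEdges : {n : ℕ} → Adj n → ℕ
numEdges {n} A = sum (map (λ i → countB (λ j → edge A i j) (allFinL n)) (allFinL n))

outDeg inDeg deg : {n : ℕ} → Adj n → Fin n → ℕ
outDeg {n} A v = countB (λ j → edge A v j) (allFinL n)
inDeg {n} A v = countB (λ i → edge A i v) (allFinL n)
deg A v = outDeg A v + inDeg A v

-- The sample space: all loopless digraphs on Fin n with exactly m edges
-- (equivalently, all m-subsets of the n(n-1) ordered pairs (i,j), i ≠ j).
Digraphs : (n : ℕ) → ℕ → List (Adj n)
Digraphs n m = Data.List.filterᵇ (λ A → noLoops A ∧ (numEdges A ≡ᵇ m)) (allAdj n)

-- d > 8m/n + 2 log₂ n   (real inequality, n ≥ 1), rewritten exactly in ℕ: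
-- ⇔ d·n − 8m > 2 n log₂ n ⇔ (d·n > 8m and 2^(d·n − 8m) > n^(2n)).
tooLarge : (n m d : ℕ) → Bool
tooLarge n m d = (8 * m <ᵇ d * n) ∧ (n ^ (2 * n) <ᵇ 2 ^ (d * n ∸ 8 * m))

Bad : (n m : ℕ) → Adj n → Bool
Bad n m A = or (map (λ v → tooLarge n m (deg A v)) (allFinL n))

{-# OPTIONS --safe #-}

-- Counting on the flattened n × n adjacency matrix, whose positions split into the n loops,
-- the 2(n − 1) positions incident to a vertex v and the (n − 1)(n − 2) others, the m-edge
-- digraphs in which v has degree k number C(2(n−1), k) · C((n−1)(n−2), m−k): a hypergeometric
-- fraction of all C(n(n−1), m) digraphs, at most (2m/n)^k / k!. Since k! ≥ (k/4)^k, a degree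
-- k > 8m/n + 2 log₂ n makes this fraction at most 1/n², and from such a k on consecutive
-- fractions shrink by a factor 4, so v has a too large degree with probability at most
-- (4/3)/n². The union bound over the n vertices gives 4/(3n) < 2/n.

module Submission where

open import Data.Bool using (Bool; true; false; T; if_then_else_; _∧_; _∨_; not)
open import Data.Bool.ListAction using (and)
open import Data.Bool.Properties using (∧-zeroʳ; ∧-identityʳ; T-∧)
open import Data.Empty using (⊥-elim)
open import Data.Fin using (Fin; zero; suc; toℕ; fromℕ<)
open import Data.Fin.Properties using (_≟_; toℕ-fromℕ<)
open import Data.List using (List; []; _∷_; _++_; map; concatMap; filterᵇ; length; tabulate; allFin)
open import Data.List.Effectful using (module MonadProperties)
open import Data.List.Properties using (map-id; ++-identityʳ; map-∘; map-concatMap; concatMap-map; concatMap-cong)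
open import Data.List.Relation.Unary.Any using (satisfied)
open import Data.List.Relation.Unary.Any.Properties using (any⁻)
open import Data.Maybe using (Maybe; just; nothing)
open import Data.Nat hiding (_≟_)
open import Data.Nat.Combinatorics
open import Data.Nat.Combinatorics.Base using (_P′_)
open import Data.Nat.Combinatorics.Specification using (nP′k≡n[n∸1P′k∸1])
import Data.Nat.ListAction as ListAction
open import Data.Nat.Properties hiding (_≟_)
open import Data.Nat.Solver using (module +-*-Solver)
open import Data.Product using (∃-syntax; _,_; _×_; proj₁; proj₂)
open import Data.Sum using (_⊎_; inj₁; inj₂)
open import Data.Vec using (Vec; []; _∷_; concat; replicate; lookup) renaming (_++_ to _++ᵛ_)
import Data.Vec as Vec
open import Data.Vec.Properties using (lookup∘tabulate; lookup-replicate)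
open import Function using (_∘_)
open import Function.Bundles using (Equivalence)
open import Relation.Binary.PropositionalEquality
open import Relation.Nullary using (yes; no; does)

open import Defs

open import Algebra.Properties.Semiring.Sum +-*-semiring
  using (sum; sum-syntax; sum-cong-≗; ∑-distrib-+; *-distribˡ-sum; sum-replicate-zero)
open import Algebra.Properties.CommutativeSemigroup *-commutativeSemigroup
  using (interchange; x∙yz≈y∙xz; xy∙z≈y∙xz)
open +-*-Solver using (solve; _:+_; _:*_; _:=_; con)

^-distribʳ-* : ∀ x y n → (x * y) ^ n ≡ x ^ n * y ^ n
^-distribʳ-* x y zero = refl
^-distribʳ-* x y (suc n) = begin
  x * y * (x * y) ^ n      ≡⟨ cong (x * y *_) (^-distribʳ-* x y n) ⟩
  x * y * (x ^ n * y ^ n)  ≡⟨ solve 4 (λ x y p q → x :* y :* (p :* q) := x :* p :* (y :* q)) refl x y (x ^ n) (y ^ n) ⟩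
  x * x ^ n * (y * y ^ n)  ∎
  where open ≡-Reasoning

^-cancelʳ-≤ : ∀ n .{{_ : NonZero n}} {x y} → x ^ n ≤ y ^ n → x ≤ y
^-cancelʳ-≤ n {x} {y} xⁿ≤yⁿ with x ≤? y
... | yes x≤y = x≤y
... | no x≰y = ⊥-elim (<⇒≱ (^-monoˡ-< n (≰⇒> x≰y)) xⁿ≤yⁿ)

-- (1 + 1/x)^k ≥ 1 + k/x, cleared of denominators.
bernoulli : ∀ x k → x ^ k * (x + k) ≤ x * suc x ^ k
bernoulli x zero = ≤-reflexive (solve 1 (λ x → con 1 :* (x :+ con 0) := x :* con 1) refl x)
bernoulli x (suc k) = begin
  x * x ^ k * (x + suc k)            ≤⟨ ≤-reflexive (solve 3 (λ x k p → x :* p :* (x :+ (con 1 :+ k)) := p :* (x :* (x :+ (con 1 :+ k)))) refl x k (x ^ k)) ⟩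
  x ^ k * (x * (x + suc k))          ≤⟨ *-monoʳ-≤ (x ^ k) (m≤m+n _ k) ⟩
  x ^ k * (x * (x + suc k) + k)      ≡⟨ solve 3 (λ x k p → p :* (x :* (x :+ (con 1 :+ k)) :+ k) := p :* (x :+ k) :* (con 1 :+ x)) refl x k (x ^ k) ⟩
  x ^ k * (x + k) * suc x            ≤⟨ *-monoˡ-≤ (suc x) (bernoulli x k) ⟩
  x * suc x ^ k * suc x              ≡⟨ solve 2 (λ x p → x :* p :* (con 1 :+ x) := x :* ((con 1 :+ x) :* p)) refl x (suc x ^ k) ⟩
  x * (suc x * suc x ^ k)            ∎
  where open ≤-Reasoning

2*n^n≤[1+n]^n : ∀ n .{{_ : NonZero n}} → 2 * n ^ n ≤ suc n ^ n
2*n^n≤[1+n]^n n = *-cancelˡ-≤ n (begin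
  n * (2 * n ^ n)  ≡⟨ solve 2 (λ n p → n :* (con 2 :* p) := p :* (n :+ n)) refl n (n ^ n) ⟩
  n ^ n * (n + n)  ≤⟨ bernoulli n n ⟩
  n * suc n ^ n    ∎)
  where open ≤-Reasoning

a^[a+c]*2^c≤[a+c]^[a+c] : ∀ a c → a ^ (a + c) * 2 ^ c ≤ (a + c) ^ (a + c)
a^[a+c]*2^c≤[a+c]^[a+c] a zero rewrite +-identityʳ a = ≤-reflexive (*-identityʳ (a ^ a))
a^[a+c]*2^c≤[a+c]^[a+c] zero (suc c) = z≤n
a^[a+c]*2^c≤[a+c]^[a+c] (suc a) (suc c) rewrite +-suc a c = begin
  suc a * suc a ^ s * (2 * 2 ^ c)  ≡⟨ solve 3 (λ a p q → a :* p :* (con 2 :* q) := con 2 :* a :* (p :* q)) refl (suc a) (suc a ^ s) (2 ^ c) ⟩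
  2 * suc a * (suc a ^ s * 2 ^ c)  ≤⟨ *-monoʳ-≤ (2 * suc a) (a^[a+c]*2^c≤[a+c]^[a+c] (suc a) c) ⟩
  2 * suc a * s ^ s                ≤⟨ *-monoˡ-≤ (s ^ s) (*-monoʳ-≤ 2 (m≤n⇒m≤1+n (m≤m+n (suc a) c))) ⟩
  2 * suc s * s ^ s                ≡⟨ solve 2 (λ t p → con 2 :* t :* p := t :* (con 2 :* p)) refl (suc s) (s ^ s) ⟩
  suc s * (2 * s ^ s)              ≤⟨ *-monoʳ-≤ (suc s) (2*n^n≤[1+n]^n s) ⟩
  suc s * suc s ^ s                ∎
  where open ≤-Reasoning
        s = suc a + c

-- (1 + 1/d)^j ≤ (d + 1)/(r + 1) for d = j + r, cleared of denominators.
bernoulli-upper : ∀ j r → suc (j + r) ^ j * suc r ≤ (j + r) ^ j * suc (j + r)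
bernoulli-upper zero r = ≤-refl
bernoulli-upper (suc j) r = *-cancelʳ-≤ _ _ (suc (suc r)) (begin
  suc d * suc d ^ j * suc r * suc (suc r)
    ≡⟨ solve 4 (λ t p a b → t :* p :* a :* b := (t :* a) :* (p :* b)) refl (suc d) (suc d ^ j) (suc r) (suc (suc r)) ⟩
  (suc d * suc r) * (suc d ^ j * suc (suc r))
    ≤⟨ *-mono-≤ step (subst (λ e → suc e ^ j * suc (suc r) ≤ e ^ j * suc e) (+-suc j r) (bernoulli-upper j (suc r))) ⟩
  (d * suc (suc r)) * (d ^ j * suc d)
    ≡⟨ solve 4 (λ t p a b → (t :* b) :* (p :* a) := t :* p :* a :* b) refl d (d ^ j) (suc d) (suc (suc r)) ⟩
  d * d ^ j * suc d * suc (suc r) ∎)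
  where
  open ≤-Reasoning
  d = suc (j + r)
  step : suc d * suc r ≤ d * suc (suc r)
  step = begin
    suc d * suc r      ≡⟨ solve 2 (λ d r → (con 1 :+ d) :* (con 1 :+ r) := d :* (con 1 :+ r) :+ (con 1 :+ r)) refl d r ⟩
    d * suc r + suc r  ≤⟨ +-monoʳ-≤ (d * suc r) (s≤s (m≤n+m r j)) ⟩
    d * suc r + d      ≡⟨ solve 2 (λ d r → d :* (con 1 :+ r) :+ d := d :* (con 2 :+ r)) refl d r ⟩
    d * suc (suc r)    ∎

even-or-odd : ∀ d → ∃[ h ] (d ≡ h + h ⊎ d ≡ suc (h + h))
even-or-odd zero = 0 , inj₁ refl
even-or-odd (suc d) with even-or-odd d
... | h , inj₁ refl = h , inj₂ refl
... | h , inj₂ refl = suc h , inj₁ (cong suc (sym (+-suc h h)))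

-- (1 + 1/d)^d = (1 + 1/d)^h₁ (1 + 1/d)^h₂ ≤ (d + 1)² / ((h₁ + 1)(h₂ + 1)), which is at most 4
-- when d = h₁ + h₂ is split evenly.
[1+d]^d≤4*d^d-split : ∀ h₁ h₂ → suc (h₁ + h₂) * suc (h₁ + h₂) ≤ 4 * (suc h₁ * suc h₂) →
                      suc (h₁ + h₂) ^ (h₁ + h₂) ≤ 4 * (h₁ + h₂) ^ (h₁ + h₂)
[1+d]^d≤4*d^d-split h₁ h₂ balanced = *-cancelʳ-≤ _ _ (suc h₁ * suc h₂) (begin
  suc d ^ d * (suc h₁ * suc h₂)
    ≡⟨ cong (_* (suc h₁ * suc h₂)) (^-distribˡ-+-* (suc d) h₁ h₂) ⟩
  suc d ^ h₁ * suc d ^ h₂ * (suc h₁ * suc h₂)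
    ≡⟨ solve 4 (λ p q a b → p :* q :* (a :* b) := (p :* b) :* (q :* a)) refl (suc d ^ h₁) (suc d ^ h₂) (suc h₁) (suc h₂) ⟩
  (suc d ^ h₁ * suc h₂) * (suc d ^ h₂ * suc h₁)
    ≤⟨ *-mono-≤ (bernoulli-upper h₁ h₂) (subst (λ e → suc e ^ h₂ * suc h₁ ≤ e ^ h₂ * suc e) (+-comm h₂ h₁) (bernoulli-upper h₂ h₁)) ⟩
  (d ^ h₁ * suc d) * (d ^ h₂ * suc d)
    ≡⟨ solve 3 (λ p q t → (p :* t) :* (q :* t) := p :* q :* (t :* t)) refl (d ^ h₁) (d ^ h₂) (suc d) ⟩
  d ^ h₁ * d ^ h₂ * (suc d * suc d)
    ≡⟨ cong (_* (suc d * suc d)) (^-distribˡ-+-* d h₁ h₂) ⟨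
  d ^ d * (suc d * suc d)
    ≤⟨ *-monoʳ-≤ (d ^ d) balanced ⟩
  d ^ d * (4 * (suc h₁ * suc h₂))
    ≡⟨ *-assoc (d ^ d) 4 _ ⟨
  d ^ d * 4 * (suc h₁ * suc h₂)
    ≡⟨ cong (_* (suc h₁ * suc h₂)) (*-comm (d ^ d) 4) ⟩
  4 * d ^ d * (suc h₁ * suc h₂) ∎)
  where open ≤-Reasoning
        d = h₁ + h₂

[1+d]^d≤4*d^d : ∀ d → suc d ^ d ≤ 4 * d ^ d
[1+d]^d≤4*d^d d with even-or-odd d
... | h , inj₁ refl = [1+d]^d≤4*d^d-split h h (≤-trans (m≤m+n _ (4 * h + 3)) (≤-reflexive
  (solve 1 (λ h → (con 1 :+ (h :+ h)) :* (con 1 :+ (h :+ h)) :+ (con 4 :* h :+ con 3) := con 4 :* ((con 1 :+ h) :* (con 1 :+ h))) refl h)))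
... | h , inj₂ refl = [1+d]^d≤4*d^d-split (suc h) h (≤-trans (m≤m+n _ (4 * h + 4)) (≤-reflexive
  (solve 1 (λ h → (con 2 :+ (h :+ h)) :* (con 2 :+ (h :+ h)) :+ (con 4 :* h :+ con 4) := con 4 :* ((con 2 :+ h) :* (con 1 :+ h))) refl h)))

n^n≤4^n*n! : ∀ n → n ^ n ≤ 4 ^ n * n !
n^n≤4^n*n! zero = ≤-refl
n^n≤4^n*n! (suc n) = begin
  suc n * suc n ^ n                ≤⟨ *-monoʳ-≤ (suc n) ([1+d]^d≤4*d^d n) ⟩
  suc n * (4 * n ^ n)              ≤⟨ *-monoʳ-≤ (suc n) (*-monoʳ-≤ 4 (n^n≤4^n*n! n)) ⟩
  suc n * (4 * (4 ^ n * n !))      ≡⟨ solve 3 (λ a p f → a :* (con 4 :* (p :* f)) := con 4 :* p :* (a :* f)) refl (suc n) (4 ^ n) (n !) ⟩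
  4 * 4 ^ n * (suc n * n !)        ∎
  where open ≤-Reasoning

-- (2m/n)^k / k! ≤ 1/n² as soon as k n − 8m > 2 n log₂ n: after raising to the n-th power this
-- follows from k^k ≤ 4^k k! and a^(a+c) 2^c ≤ (a+c)^(a+c) with a = 8m, c = k n − 8m.
n*n*[2m]^k≤k!*n^k : ∀ n m k .{{_ : NonZero n}} → 8 * m ≤ k * n → n ^ (2 * n) ≤ 2 ^ (k * n ∸ 8 * m) →
                    n * n * (2 * m) ^ k ≤ k ! * n ^ k
n*n*[2m]^k≤k!*n^k n m k 8m≤kn gap = ^-cancelʳ-≤ n (*-cancelʳ-≤ _ _ (4 ^ (k * n)) {{m^n≢0 4 (k * n)}} (begin
  (n * n * (2 * m) ^ k) ^ n * 4 ^ (k * n)   ≡⟨ lhs-power ⟩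
  n ^ (2 * n) * (8 * m) ^ (k * n)           ≤⟨ *-monoˡ-≤ _ gap ⟩
  2 ^ c * (8 * m) ^ (k * n)                 ≡⟨ *-comm (2 ^ c) _ ⟩
  (8 * m) ^ (k * n) * 2 ^ c                 ≡⟨ cong (λ e → (8 * m) ^ e * 2 ^ c) (m+[n∸m]≡n 8m≤kn) ⟨
  (8 * m) ^ (8 * m + c) * 2 ^ c             ≤⟨ a^[a+c]*2^c≤[a+c]^[a+c] (8 * m) c ⟩
  (8 * m + c) ^ (8 * m + c)                 ≡⟨ cong (λ e → e ^ e) (m+[n∸m]≡n 8m≤kn) ⟩
  (k * n) ^ (k * n)                         ≤⟨ rhs-power ⟩
  (k ! * n ^ k) ^ n * 4 ^ (k * n)           ∎))
  where
  open ≤-Reasoning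
  c = k * n ∸ 8 * m
  [n*n]^n≡n^[2n] : (n * n) ^ n ≡ n ^ (2 * n)
  [n*n]^n≡n^[2n] = trans (^-distribʳ-* n n n) (sym (trans (^-distribˡ-+-* n n (n + 0))
                                                     (cong (λ e → n ^ n * n ^ e) (+-identityʳ n))))
  lhs-power : (n * n * (2 * m) ^ k) ^ n * 4 ^ (k * n) ≡ n ^ (2 * n) * (8 * m) ^ (k * n)
  lhs-power = begin-equality
    (n * n * (2 * m) ^ k) ^ n * 4 ^ (k * n)
      ≡⟨ cong (_* 4 ^ (k * n)) (^-distribʳ-* (n * n) ((2 * m) ^ k) n) ⟩
    (n * n) ^ n * ((2 * m) ^ k) ^ n * 4 ^ (k * n)
      ≡⟨ cong (λ a → (n * n) ^ n * a * 4 ^ (k * n)) (^-*-assoc (2 * m) k n) ⟩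
    (n * n) ^ n * (2 * m) ^ (k * n) * 4 ^ (k * n)
      ≡⟨ *-assoc ((n * n) ^ n) _ _ ⟩
    (n * n) ^ n * ((2 * m) ^ (k * n) * 4 ^ (k * n))
      ≡⟨ cong ((n * n) ^ n *_) (^-distribʳ-* (2 * m) 4 (k * n)) ⟨
    (n * n) ^ n * (2 * m * 4) ^ (k * n)
      ≡⟨ cong₂ (λ a b → a * b ^ (k * n)) [n*n]^n≡n^[2n] (solve 1 (λ m → con 2 :* m :* con 4 := con 8 :* m) refl m) ⟩
    n ^ (2 * n) * (8 * m) ^ (k * n) ∎
  rhs-power : (k * n) ^ (k * n) ≤ (k ! * n ^ k) ^ n * 4 ^ (k * n)
  rhs-power = begin
    (k * n) ^ (k * n)                         ≡⟨ ^-distribʳ-* k n (k * n) ⟩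
    k ^ (k * n) * n ^ (k * n)                 ≡⟨ cong₂ _*_ (^-*-assoc k k n) (^-*-assoc n k n) ⟨
    (k ^ k) ^ n * (n ^ k) ^ n                 ≤⟨ *-monoˡ-≤ _ (^-monoˡ-≤ n (n^n≤4^n*n! k)) ⟩
    (4 ^ k * k !) ^ n * (n ^ k) ^ n           ≡⟨ cong (_* (n ^ k) ^ n) (^-distribʳ-* (4 ^ k) (k !) n) ⟩
    (4 ^ k) ^ n * (k !) ^ n * (n ^ k) ^ n     ≡⟨ cong (λ a → a * (k !) ^ n * (n ^ k) ^ n) (^-*-assoc 4 k n) ⟩
    4 ^ (k * n) * (k !) ^ n * (n ^ k) ^ n     ≡⟨ solve 3 (λ p f q → p :* f :* q := f :* q :* p) refl (4 ^ (k * n)) ((k !) ^ n) ((n ^ k) ^ n) ⟩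
    (k !) ^ n * (n ^ k) ^ n * 4 ^ (k * n)     ≡⟨ cong (_* 4 ^ (k * n)) (^-distribʳ-* (k !) (n ^ k) n) ⟨
    (k ! * n ^ k) ^ n * 4 ^ (k * n)           ∎

[2m/n]^k/k!-ratio : ∀ n m k c → 8 * m ≤ suc k * n →
                    4 * ((2 * m) ^ suc k * c) * (k ! * n ^ k) ≤ (2 * m) ^ k * c * (suc k ! * n ^ suc k)
[2m/n]^k/k!-ratio n m k c 8m≤[1+k]n = begin
  4 * (2 * m * p * c) * (k ! * n ^ k)    ≡⟨ solve 5 (λ m p c f q → con 4 :* (con 2 :* m :* p :* c) :* (f :* q) := con 8 :* m :* (p :* c :* (f :* q))) refl m p c (k !) (n ^ k) ⟩
  8 * m * (p * c * (k ! * n ^ k))        ≤⟨ *-monoˡ-≤ (p * c * (k ! * n ^ k)) 8m≤[1+k]n ⟩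
  suc k * n * (p * c * (k ! * n ^ k))    ≡⟨ solve 6 (λ a n p c f q → a :* n :* (p :* c :* (f :* q)) := p :* c :* (a :* f :* (n :* q))) refl (suc k) n p c (k !) (n ^ k) ⟩
  p * c * (suc k * k ! * (n * n ^ k))    ∎
  where open ≤-Reasoning
        p = (2 * m) ^ k

tooLarge⇒ : ∀ {n m k} → T (tooLarge n m k) → 8 * m < k * n × n ^ (2 * n) < 2 ^ (k * n ∸ 8 * m)
tooLarge⇒ {n} {m} {k} large with Equivalence.to T-∧ large
... | 8m<ᵇkn , gap = <ᵇ⇒< (8 * m) (k * n) 8m<ᵇkn , <ᵇ⇒< (n ^ (2 * n)) (2 ^ (k * n ∸ 8 * m)) gap

tooLarge-suc : ∀ n m k → T (tooLarge n m k) → T (tooLarge n m (suc k))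
tooLarge-suc n m k large with tooLarge⇒ {n} {m} {k} large
... | 8m<kn , gap = Equivalence.from T-∧ (<⇒<ᵇ (<-≤-trans 8m<kn kn≤[1+k]n) ,
                                           <⇒<ᵇ (<-≤-trans gap (^-monoʳ-≤ 2 (∸-monoˡ-≤ (8 * m) kn≤[1+k]n))))
  where kn≤[1+k]n = m≤n+m (k * n) n

[1+n]C[1+k]≡nCk+nC[1+k] : ∀ n k → suc n C suc k ≡ n C k + n C suc k
[1+n]C[1+k]≡nCk+nC[1+k] n k = sym (nCk+nC[k+1]≡[n+1]C[k+1] n k)

[1+k]*[1+n]C[1+k]≡[1+n]*nCk : ∀ n k → suc k * (suc n C suc k) ≡ suc n * (n C k)
[1+k]*[1+n]C[1+k]≡[1+n]*nCk zero zero = refl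
[1+k]*[1+n]C[1+k]≡[1+n]*nCk zero (suc k) = *-zeroʳ (suc (suc k))
[1+k]*[1+n]C[1+k]≡[1+n]*nCk (suc n) zero =
  trans (*-identityˡ (suc (suc n) C 1)) (trans (nC1≡n (suc (suc n))) (sym (*-identityʳ (suc (suc n)))))
[1+k]*[1+n]C[1+k]≡[1+n]*nCk (suc n) (suc k) = begin
  suc (suc k) * (suc (suc n) C suc (suc k))
    ≡⟨ cong (suc (suc k) *_) ([1+n]C[1+k]≡nCk+nC[1+k] (suc n) (suc k)) ⟩
  suc (suc k) * (X + Z)
    ≡⟨ solve 3 (λ k x z → (con 2 :+ k) :* (x :+ z) := x :+ ((con 1 :+ k) :* x :+ (con 2 :+ k) :* z)) refl k X Z ⟩
  X + (suc k * X + suc (suc k) * Z)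
    ≡⟨ cong₂ (λ a b → X + (a + b)) ([1+k]*[1+n]C[1+k]≡[1+n]*nCk n k) ([1+k]*[1+n]C[1+k]≡[1+n]*nCk n (suc k)) ⟩
  X + (suc n * (n C k) + suc n * (n C suc k))
    ≡⟨ cong (X +_) (*-distribˡ-+ (suc n) (n C k) (n C suc k)) ⟨
  X + suc n * (n C k + n C suc k)
    ≡⟨ cong (λ y → X + suc n * y) ([1+n]C[1+k]≡nCk+nC[1+k] n k) ⟨
  suc (suc n) * X ∎
  where open ≡-Reasoning
        X = suc n C suc k
        Z = suc n C suc (suc k)

nCk≤[1+n]Ck : ∀ n k → n C k ≤ suc n C k
nCk≤[1+n]Ck n zero = ≤-refl
nCk≤[1+n]Ck n (suc k) = ≤-trans (m≤n+m (n C suc k) (n C k)) (≤-reflexive (nCk+nC[k+1]≡[n+1]C[k+1] n k))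

C-monoˡ-≤ : ∀ k {n n′} → n ≤ n′ → n C k ≤ n′ C k
C-monoˡ-≤ k {n} {n′} n≤n′ with m≤n⇒∃[o]m+o≡n n≤n′
... | d , refl = go d
  where go : ∀ d → n C k ≤ (n + d) C k
        go zero = ≤-reflexive (cong (_C k) (sym (+-identityʳ n)))
        go (suc d) = ≤-trans (go d) (≤-trans (nCk≤[1+n]Ck (n + d) k) (≤-reflexive (cong (_C k) (sym (+-suc n d)))))

nCk>0 : ∀ {n k} → k ≤ n → 0 < n C k
nCk>0 {n} {zero} _ = z<s
nCk>0 {suc n} {suc k} (s≤s k≤n) = ≤-trans (nCk>0 k≤n) (≤-trans (m≤m+n (n C k) (n C suc k)) (≤-reflexive (nCk+nC[k+1]≡[n+1]C[k+1] n k)))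

nPk≡nP′k : ∀ {n k} → k ≤ n → n P k ≡ n P′ k
nPk≡nP′k {n} {k} k≤n with k ≤ᵇ n | ≤⇒≤ᵇ k≤n
... | true | _ = refl

[1+n]P[1+k]≡[1+n]*nPk : ∀ n k → suc n P suc k ≡ suc n * (n P k)
[1+n]P[1+k]≡[1+n]*nPk n k with k ≤? n
... | yes k≤n = trans (nPk≡nP′k (s≤s k≤n)) (trans (nP′k≡n[n∸1P′k∸1] (suc n) (suc k)) (cong (suc n *_) (sym (nPk≡nP′k k≤n))))
... | no k≰n = trans (k>n⇒nPk≡0 (s<s (≰⇒> k≰n))) (sym (trans (cong (suc n *_) (k>n⇒nPk≡0 (≰⇒> k≰n))) (*-zeroʳ (suc n))))

nCk*k!≡nPk : ∀ n k → (n C k) * k ! ≡ n P k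
nCk*k!≡nPk n zero = refl
nCk*k!≡nPk zero (suc k) = refl
nCk*k!≡nPk (suc n) (suc k) = begin
  (suc n C suc k) * (suc k * k !)    ≡⟨ solve 3 (λ c a f → c :* (a :* f) := a :* c :* f) refl (suc n C suc k) (suc k) (k !) ⟩
  suc k * (suc n C suc k) * k !      ≡⟨ cong (_* k !) ([1+k]*[1+n]C[1+k]≡[1+n]*nCk n k) ⟩
  suc n * (n C k) * k !              ≡⟨ *-assoc (suc n) (n C k) (k !) ⟩
  suc n * ((n C k) * k !)            ≡⟨ cong (suc n *_) (nCk*k!≡nPk n k) ⟩
  suc n * (n P k)                    ≡⟨ [1+n]P[1+k]≡[1+n]*nPk n k ⟨
  suc n P suc k                      ∎
  where open ≡-Reasoning

nPk>0 : ∀ {n k} → k ≤ n → 0 < n P k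
nPk>0 {n} {k} k≤n = subst (0 <_) (nCk*k!≡nPk n k) (*-mono-≤ (nCk>0 k≤n) (1≤n! k))

nPk≤n^k : ∀ n k → n P k ≤ n ^ k
nPk≤n^k n zero = ≤-refl
nPk≤n^k zero (suc k) = z≤n
nPk≤n^k (suc n) (suc k) = begin
  suc n P suc k       ≡⟨ [1+n]P[1+k]≡[1+n]*nPk n k ⟩
  suc n * (n P k)     ≤⟨ *-monoʳ-≤ (suc n) (≤-trans (nPk≤n^k n k) (^-monoˡ-≤ k (n≤1+n n))) ⟩
  suc n * suc n ^ k   ∎
  where open ≤-Reasoning

[n∸k]C[m∸k]*nPk≡nCm*mPk : ∀ n m k → k ≤ m → ((n ∸ k) C (m ∸ k)) * (n P k) ≡ (n C m) * (m P k)
[n∸k]C[m∸k]*nPk≡nCm*mPk n m zero _ = refl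
[n∸k]C[m∸k]*nPk≡nCm*mPk zero (suc m) (suc k) _ = *-zeroʳ (0 C (m ∸ k))
[n∸k]C[m∸k]*nPk≡nCm*mPk (suc n) (suc m) (suc k) (s≤s k≤m) = begin
  ((n ∸ k) C (m ∸ k)) * (suc n P suc k)     ≡⟨ cong (((n ∸ k) C (m ∸ k)) *_) ([1+n]P[1+k]≡[1+n]*nPk n k) ⟩
  ((n ∸ k) C (m ∸ k)) * (suc n * (n P k))   ≡⟨ x∙yz≈y∙xz ((n ∸ k) C (m ∸ k)) (suc n) (n P k) ⟩
  suc n * (((n ∸ k) C (m ∸ k)) * (n P k))   ≡⟨ cong (suc n *_) ([n∸k]C[m∸k]*nPk≡nCm*mPk n m k k≤m) ⟩
  suc n * ((n C m) * (m P k))               ≡⟨ *-assoc (suc n) (n C m) (m P k) ⟨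
  suc n * (n C m) * (m P k)                 ≡⟨ cong (_* (m P k)) ([1+k]*[1+n]C[1+k]≡[1+n]*nCk n m) ⟨
  suc m * (suc n C suc m) * (m P k)         ≡⟨ xy∙z≈y∙xz (suc m) (suc n C suc m) (m P k) ⟩
  (suc n C suc m) * (suc m * (m P k))       ≡⟨ cong ((suc n C suc m) *_) ([1+n]P[1+k]≡[1+n]*nPk m k) ⟨
  (suc n C suc m) * (suc m P suc k)         ∎
  where open ≡-Reasoning

IPk*n^k≤q^k*NPk : ∀ q .{{_ : NonZero q}} {n} I N k → q ≤ n → I * n ≤ q * N → (I P k) * n ^ k ≤ q ^ k * (N P k)
IPk*n^k≤q^k*NPk q I N zero _ _ = ≤-refl
IPk*n^k≤q^k*NPk q zero N (suc k) _ _ = z≤n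
IPk*n^k≤q^k*NPk q {n} (suc I) zero (suc k) q≤n In≤qN =
  ⊥-elim (<⇒≱ (<-≤-trans (<-≤-trans (>-nonZero⁻¹ q) q≤n) (m≤n*m n (suc I))) (≤-trans In≤qN (≤-reflexive (*-zeroʳ q))))
IPk*n^k≤q^k*NPk q {n} (suc I) (suc N) (suc k) q≤n In≤qN = begin
  (suc I P suc k) * (n * n ^ k)     ≡⟨ cong (_* (n * n ^ k)) ([1+n]P[1+k]≡[1+n]*nPk I k) ⟩
  suc I * (I P k) * (n * n ^ k)     ≡⟨ interchange (suc I) (I P k) n (n ^ k) ⟩
  (suc I * n) * ((I P k) * n ^ k)   ≤⟨ *-mono-≤ In≤qN (IPk*n^k≤q^k*NPk q I N k q≤n In≤qN′) ⟩
  (q * suc N) * (q ^ k * (N P k))   ≡⟨ interchange q (suc N) (q ^ k) (N P k) ⟩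
  q * q ^ k * (suc N * (N P k))     ≡⟨ cong (q * q ^ k *_) ([1+n]P[1+k]≡[1+n]*nPk N k) ⟨
  q * q ^ k * (suc N P suc k)       ∎
  where
  open ≤-Reasoning
  In≤qN′ : I * n ≤ q * N
  In≤qN′ = +-cancelʳ-≤ q (I * n) (q * N) (begin
    I * n + q      ≤⟨ +-monoʳ-≤ (I * n) q≤n ⟩
    I * n + n      ≡⟨ +-comm (I * n) n ⟩
    suc I * n      ≤⟨ In≤qN ⟩
    q * suc N      ≡⟨ *-suc q N ⟩
    q + q * N      ≡⟨ +-comm q (q * N) ⟩
    q * N + q      ∎)

hypergeometric-bound : ∀ q .{{_ : NonZero q}} {n} I R m k → q ≤ n → I * n ≤ q * (I + R) → k ≤ m →
                       (I C k) * (R C (m ∸ k)) * k ! * n ^ k ≤ (q * m) ^ k * ((I + R) C m)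
hypergeometric-bound q {n} I R m k q≤n In≤qN k≤m with k ≤? I
... | no k≰I rewrite k>n⇒nCk≡0 (≰⇒> k≰I) = z≤n
... | yes k≤I = *-cancelʳ-≤ _ _ (N P k) {{>-nonZero (nPk>0 (≤-trans k≤I (m≤m+n I R)))}} (begin
  (I C k) * (R C (m ∸ k)) * k ! * n ^ k * (N P k)
    ≡⟨ solve 5 (λ a b f p x → a :* b :* f :* p :* x := b :* (a :* f) :* p :* x) refl (I C k) (R C (m ∸ k)) (k !) (n ^ k) (N P k) ⟩
  (R C (m ∸ k)) * ((I C k) * k !) * n ^ k * (N P k)
    ≡⟨ cong (λ a → (R C (m ∸ k)) * a * n ^ k * (N P k)) (nCk*k!≡nPk I k) ⟩
  (R C (m ∸ k)) * (I P k) * n ^ k * (N P k)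
    ≤⟨ *-monoˡ-≤ (N P k) (*-monoˡ-≤ (n ^ k) (*-monoˡ-≤ (I P k) (C-monoˡ-≤ (m ∸ k) R≤N∸k))) ⟩
  ((N ∸ k) C (m ∸ k)) * (I P k) * n ^ k * (N P k)
    ≡⟨ solve 4 (λ c p x y → c :* p :* x :* y := (c :* y) :* (p :* x)) refl ((N ∸ k) C (m ∸ k)) (I P k) (n ^ k) (N P k) ⟩
  ((N ∸ k) C (m ∸ k)) * (N P k) * ((I P k) * n ^ k)
    ≡⟨ cong (_* ((I P k) * n ^ k)) ([n∸k]C[m∸k]*nPk≡nCm*mPk N m k k≤m) ⟩
  (N C m) * (m P k) * ((I P k) * n ^ k)
    ≤⟨ *-mono-≤ (*-monoʳ-≤ (N C m) (nPk≤n^k m k)) (IPk*n^k≤q^k*NPk q I N k q≤n In≤qN) ⟩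
  (N C m) * m ^ k * (q ^ k * (N P k))
    ≡⟨ solve 4 (λ c x y p → c :* x :* (y :* p) := y :* x :* c :* p) refl (N C m) (m ^ k) (q ^ k) (N P k) ⟩
  q ^ k * m ^ k * (N C m) * (N P k)
    ≡⟨ cong (λ a → a * (N C m) * (N P k)) (^-distribʳ-* q m k) ⟨
  (q * m) ^ k * (N C m) * (N P k) ∎)
  where
  open ≤-Reasoning
  N = I + R
  R≤N∸k : R ≤ N ∸ k
  R≤N∸k = subst (_≤ N ∸ k) (m+n∸m≡n I R) (∸-monoʳ-≤ N k≤I)

∑-const : ∀ n c → ∑[ i < n ] c ≡ n * c
∑-const zero c = refl
∑-const (suc n) c = cong (c +_) (∑-const n c)

∑-mono-≤ : ∀ {n} {f g : Fin n → ℕ} → (∀ i → f i ≤ g i) → sum f ≤ sum g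
∑-mono-≤ {zero} f≤g = z≤n
∑-mono-≤ {suc n} f≤g = +-mono-≤ (f≤g zero) (∑-mono-≤ (f≤g ∘ suc))

term≤∑ : ∀ {n} (f : Fin n → ℕ) i → f i ≤ sum f
term≤∑ f zero = m≤m+n (f zero) _
term≤∑ f (suc i) = ≤-trans (term≤∑ (f ∘ suc) i) (m≤n+m _ (f zero))

∑-δ : ∀ {n} (v : Fin n) (f : Fin n → ℕ) → ∑[ i < n ] (if does (i ≟ v) then f i else 0) ≡ f v
∑-δ {suc n} zero f = trans (cong (f zero +_) (sum-replicate-zero n)) (+-identityʳ (f zero))
∑-δ {suc n} (suc v) f = ∑-δ v (f ∘ suc)

∑-if : ∀ {n} b (f : Fin n → ℕ) → ∑[ i < n ] (if b then f i else 0) ≡ (if b then sum f else 0)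
∑-if true f = refl
∑-if {n} false f = sum-replicate-zero n

∑²-distrib-+ : ∀ {n} (f g : Fin n → Fin n → ℕ) →
               ∑[ i < n ] ∑[ j < n ] (f i j + g i j) ≡ ∑[ i < n ] ∑[ j < n ] f i j + ∑[ i < n ] ∑[ j < n ] g i j
∑²-distrib-+ {n} f g = trans (sum-cong-≗ (λ i → ∑-distrib-+ (f i) (g i))) (∑-distrib-+ (λ i → ∑[ j < n ] f i j) (λ i → ∑[ j < n ] g i j))

𝟙 : Bool → ℕ
𝟙 b = if b then 1 else 0

T⇒𝟙≡1 : ∀ {b} → T b → 𝟙 b ≡ 1
T⇒𝟙≡1 {true} _ = refl

geometric-tail : ∀ q l (x u v : ℕ → ℕ) → (∀ k → 0 < v k) →
                 (∀ k → k < l → x k * v k ≤ u k) →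
                 (∀ k → suc q * u (suc k) * v k ≤ u k * v (suc k)) →
                 q * v 0 * ∑[ k < l ] x (toℕ k) ≤ suc q * u 0
geometric-tail q zero x u v v>0 xv≤u ratio = ≤-trans (≤-reflexive (*-zeroʳ (q * v 0))) z≤n
geometric-tail q (suc l) x u v v>0 xv≤u ratio = begin
  q * v 0 * (x 0 + S)            ≡⟨ solve 4 (λ q v x s → q :* v :* (x :+ s) := q :* (x :* v) :+ q :* v :* s) refl q (v 0) (x 0) S ⟩
  q * (x 0 * v 0) + q * v 0 * S  ≤⟨ +-mono-≤ (*-monoʳ-≤ q (xv≤u 0 z<s)) tail-bound ⟩
  q * u 0 + u 0                  ≡⟨ +-comm (q * u 0) (u 0) ⟩
  suc q * u 0                    ∎
  where
  open ≤-Reasoning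
  S = ∑[ k < l ] x (suc (toℕ k))
  tail-bound : q * v 0 * S ≤ u 0
  tail-bound = *-cancelʳ-≤ _ _ (v 1) {{>-nonZero (v>0 1)}} (begin
    q * v 0 * S * v 1      ≡⟨ solve 4 (λ q v w s → q :* v :* s :* w := v :* (q :* w :* s)) refl q (v 0) (v 1) S ⟩
    v 0 * (q * v 1 * S)    ≤⟨ *-monoʳ-≤ (v 0) (geometric-tail q l (x ∘ suc) (u ∘ suc) (v ∘ suc) (v>0 ∘ suc) (λ k k<l → xv≤u (suc k) (s<s k<l)) (ratio ∘ suc)) ⟩
    v 0 * (suc q * u 1)    ≡⟨ *-comm (v 0) (suc q * u 1) ⟩
    suc q * u 1 * v 0      ≤⟨ ratio 0 ⟩
    u 0 * v 1              ∎)

upward-closed-tail : ∀ q d total (bad : ℕ → Bool) l (x u v : ℕ → ℕ) →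
                     (∀ k → T (bad k) → T (bad (suc k))) → (∀ k → 0 < v k) →
                     (∀ k → k < l → x k * v k ≤ u k) →
                     (∀ k → T (bad k) → suc q * u (suc k) * v k ≤ u k * v (suc k)) →
                     (∀ k → T (bad k) → d * u k ≤ v k * total) →
                     d * (q * ∑[ k < l ] (𝟙 (bad (toℕ k)) * x (toℕ k))) ≤ suc q * total
upward-closed-tail q d total bad zero x u v _ _ _ _ _ = ≤-trans (≤-reflexive (trans (cong (d *_) (*-zeroʳ q)) (*-zeroʳ d))) z≤n
upward-closed-tail q d total bad (suc l) x u v bad-suc v>0 xv≤u ratio du≤v*total with bad 0 in bad0
... | false = upward-closed-tail q d total (bad ∘ suc) l (x ∘ suc) (u ∘ suc) (v ∘ suc) (bad-suc ∘ suc) (v>0 ∘ suc)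
                (λ k k<l → xv≤u (suc k) (s<s k<l)) (ratio ∘ suc) (du≤v*total ∘ suc)
... | true = *-cancelʳ-≤ _ _ (v 0) {{>-nonZero (v>0 0)}} (begin
  d * (q * (1 * x 0 + S)) * v 0        ≡⟨ cong (λ s → d * (q * s) * v 0) weights-one ⟩
  d * (q * Σx) * v 0                   ≡⟨ solve 4 (λ d q s w → d :* (q :* s) :* w := d :* (q :* w :* s)) refl d q Σx (v 0) ⟩
  d * (q * v 0 * Σx)                   ≤⟨ *-monoʳ-≤ d (geometric-tail q (suc l) x u v v>0 xv≤u (λ k → ratio k (bad-everywhere k))) ⟩
  d * (suc q * u 0)                    ≡⟨ x∙yz≈y∙xz d (suc q) (u 0) ⟩
  suc q * (d * u 0)                    ≤⟨ *-monoʳ-≤ (suc q) (du≤v*total 0 (bad-everywhere 0)) ⟩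
  suc q * (v 0 * total)                ≡⟨ solve 3 (λ q w t → q :* (w :* t) := q :* t :* w) refl (suc q) (v 0) total ⟩
  suc q * total * v 0                  ∎)
  where
  open ≤-Reasoning
  bad-everywhere : ∀ k → T (bad k)
  bad-everywhere zero = subst T (sym bad0) _
  bad-everywhere (suc k) = bad-suc k (bad-everywhere k)
  S = ∑[ k < l ] (𝟙 (bad (suc (toℕ k))) * x (suc (toℕ k)))
  Σx = ∑[ k < suc l ] x (toℕ k)
  weights-one : 1 * x 0 + S ≡ x 0 + ∑[ k < l ] x (suc (toℕ k))
  weights-one = cong₂ _+_ (*-identityˡ (x 0))
    (sum-cong-≗ {l} (λ k → trans (cong (_* x (suc (toℕ k))) (T⇒𝟙≡1 (bad-everywhere (suc (toℕ k))))) (*-identityˡ _)))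

private variable
  X Y : Set

length-filterᵇ : ∀ (p : X → Bool) xs → length (filterᵇ p xs) ≡ countB p xs
length-filterᵇ p [] = refl
length-filterᵇ p (x ∷ xs) with p x
... | true = cong suc (length-filterᵇ p xs)
... | false = length-filterᵇ p xs

countB-filterᵇ : ∀ (p q : X → Bool) xs → countB q (filterᵇ p xs) ≡ countB (λ x → p x ∧ q x) xs
countB-filterᵇ p q [] = refl
countB-filterᵇ p q (x ∷ xs) with p x
... | true = cong (𝟙 (q x) +_) (countB-filterᵇ p q xs)
... | false = countB-filterᵇ p q xs

countB-cong : ∀ {p q : X → Bool} → (∀ x → p x ≡ q x) → ∀ xs → countB p xs ≡ countB q xs
countB-cong p≗q [] = refl
countB-cong p≗q (x ∷ xs) = cong₂ _+_ (cong 𝟙 (p≗q x)) (countB-cong p≗q xs)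

countB-false : ∀ (xs : List X) → countB (λ _ → false) xs ≡ 0
countB-false [] = refl
countB-false (x ∷ xs) = countB-false xs

countB-∧ˡ : ∀ b (p : X → Bool) xs → countB (λ x → b ∧ p x) xs ≡ 𝟙 b * countB p xs
countB-∧ˡ false p xs = countB-false xs
countB-∧ˡ true p xs = sym (+-identityʳ (countB p xs))

countB-++ : ∀ (p : X → Bool) xs ys → countB p (xs ++ ys) ≡ countB p xs + countB p ys
countB-++ p [] ys = refl
countB-++ p (x ∷ xs) ys = trans (cong (𝟙 (p x) +_) (countB-++ p xs ys)) (sym (+-assoc (𝟙 (p x)) _ _))

countB-map : ∀ (p : Y → Bool) (f : X → Y) xs → countB p (map f xs) ≡ countB (p ∘ f) xs
countB-map p f [] = refl
countB-map p f (x ∷ xs) = cong (𝟙 (p (f x)) +_) (countB-map p f xs)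

countB-tabulate : ∀ {n} (p : X → Bool) (f : Fin n → X) → countB p (tabulate f) ≡ ∑[ i < n ] 𝟙 (p (f i))
countB-tabulate {n = zero} p f = refl
countB-tabulate {n = suc n} p f = cong (𝟙 (p (f zero)) +_) (countB-tabulate p (f ∘ suc))

sum-map-tabulate : ∀ {n} (g : X → ℕ) (f : Fin n → X) → ListAction.sum (map g (tabulate f)) ≡ ∑[ i < n ] g (f i)
sum-map-tabulate {n = zero} g f = refl
sum-map-tabulate {n = suc n} g f = cong (g (f zero) +_) (sum-map-tabulate g (f ∘ suc))

countB-≤-∑ : ∀ {r} (p : X → Bool) (q : Fin r → X → Bool) → (∀ x → T (p x) → ∃[ i ] T (q i x)) →
             ∀ xs → countB p xs ≤ ∑[ i < r ] countB (q i) xs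
countB-≤-∑ p q p⇒q [] = z≤n
countB-≤-∑ {r = r} p q p⇒q (x ∷ xs) = begin
  𝟙 (p x) + countB p xs                                    ≤⟨ +-mono-≤ (𝟙p≤∑ (p x) refl) (countB-≤-∑ p q p⇒q xs) ⟩
  ∑[ i < r ] 𝟙 (q i x) + ∑[ i < r ] countB (q i) xs        ≡⟨ ∑-distrib-+ (λ i → 𝟙 (q i x)) (λ i → countB (q i) xs) ⟨
  ∑[ i < r ] (𝟙 (q i x) + countB (q i) xs)                 ∎
  where
  open ≤-Reasoning
  𝟙p≤∑ : ∀ b → p x ≡ b → 𝟙 b ≤ ∑[ i < r ] 𝟙 (q i x)
  𝟙p≤∑ false _ = z≤n
  𝟙p≤∑ true px with p⇒q x (subst T (sym px) _)
  ... | i , qix = ≤-trans (≤-reflexive (sym (T⇒𝟙≡1 qix))) (term≤∑ (λ j → 𝟙 (q j x)) i)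

allVec-+ : ∀ (xs : List X) k l → allVec xs (k + l) ≡ concatMap (λ u → map (u ++ᵛ_) (allVec xs l)) (allVec xs k)
allVec-+ xs zero l = sym (trans (++-identityʳ _) (map-id (allVec xs l)))
allVec-+ xs (suc k) l = begin
  concatMap (λ x → map (x ∷_) (allVec xs (k + l))) xs
    ≡⟨ concatMap-cong (λ x → cong (map (x ∷_)) (allVec-+ xs k l)) xs ⟩
  concatMap (λ x → map (x ∷_) (concatMap (λ u → map (u ++ᵛ_) tails) (allVec xs k))) xs
    ≡⟨ concatMap-cong (λ x → trans (map-concatMap (x ∷_) (λ u → map (u ++ᵛ_) tails) (allVec xs k))
                                   (concatMap-cong (λ u → sym (map-∘ tails)) (allVec xs k))) xs ⟩
  concatMap (λ x → concatMap (λ u → map (λ w → x ∷ (u ++ᵛ w)) tails) (allVec xs k)) xs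
    ≡⟨ concatMap-cong (λ x → concatMap-map (λ u → map (u ++ᵛ_) tails) (x ∷_) (allVec xs k)) xs ⟨
  concatMap (λ x → concatMap (λ u → map (u ++ᵛ_) tails) (map (x ∷_) (allVec xs k))) xs
    ≡⟨ MonadProperties.associative xs (λ x → map (x ∷_) (allVec xs k)) (λ u → map (u ++ᵛ_) tails) ⟩
  concatMap (λ u → map (u ++ᵛ_) tails) (concatMap (λ x → map (x ∷_) (allVec xs k)) xs) ∎
  where open ≡-Reasoning
        tails = allVec xs l

map-concat-allVec : ∀ (xs : List X) k r → map concat (allVec (allVec xs k) r) ≡ allVec xs (r * k)
map-concat-allVec xs k zero = refl
map-concat-allVec xs k (suc r) = begin
  map concat (concatMap (λ row → map (row ∷_) rows) (allVec xs k))
    ≡⟨ map-concatMap concat (λ row → map (row ∷_) rows) (allVec xs k) ⟩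
  concatMap (λ row → map concat (map (row ∷_) rows)) (allVec xs k)
    ≡⟨ concatMap-cong (λ row → trans (sym (map-∘ rows)) (trans (map-∘ rows) (cong (map (row ++ᵛ_)) (map-concat-allVec xs k r)))) (allVec xs k) ⟩
  concatMap (λ row → map (row ++ᵛ_) (allVec xs (r * k))) (allVec xs k)
    ≡⟨ allVec-+ xs k (r * k) ⟨
  allVec xs (k + r * k) ∎
  where open ≡-Reasoning
        rows = allVec (allVec xs k) r

countB-concat : ∀ (xs : List X) k r (Q : Vec X (r * k) → Bool) →
                countB (Q ∘ concat) (allVec (allVec xs k) r) ≡ countB Q (allVec xs (r * k))
countB-concat xs k r Q = trans (sym (countB-map Q concat (allVec (allVec xs k) r))) (cong (countB Q) (map-concat-allVec xs k r))

and-map-not : ∀ (p : X → Bool) xs → and (map (not ∘ p) xs) ≡ (countB p xs ≡ᵇ 0)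
and-map-not p [] = refl
and-map-not p (x ∷ xs) with p x
... | true = refl
... | false = and-map-not p xs

replicate-++ : ∀ m k (x : X) → replicate m x ++ᵛ replicate k x ≡ replicate (m + k) x
replicate-++ zero k x = refl
replicate-++ (suc m) k x = cong (x ∷_) (replicate-++ m k x)

concat-replicate : ∀ r k (x : X) → concat (replicate r (replicate k x)) ≡ replicate (r * k) x
concat-replicate zero k x = refl
concat-replicate (suc r) k x = trans (cong (replicate k x ++ᵛ_) (concat-replicate r k x)) (replicate-++ k (r * k) x)

data Class : Set where
  loop incident other : Class

_=ᶜ_ : Class → Class → Bool
loop     =ᶜ loop     = true
incident =ᶜ incident = true
other    =ᶜ other    = true
_        =ᶜ _        = false

ones : ∀ {K} → Class → Vec Class K → Vec Bool K → ℕ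
ones c [] [] = 0
ones c (d ∷ cs) (b ∷ bs) = 𝟙 (b ∧ (d =ᶜ c)) + ones c cs bs

size : ∀ {K} → Class → Vec Class K → ℕ
size {K} c cs = ones c cs (replicate K true)

ones-++ : ∀ {k l} c (xs : Vec Class k) (ys : Vec Class l) bs bs′ → ones c (xs ++ᵛ ys) (bs ++ᵛ bs′) ≡ ones c xs bs + ones c ys bs′
ones-++ c [] ys [] bs′ = refl
ones-++ c (x ∷ xs) ys (b ∷ bs) bs′ = trans (cong (𝟙 (b ∧ (x =ᶜ c)) +_) (ones-++ c xs ys bs bs′)) (sym (+-assoc (𝟙 (b ∧ (x =ᶜ c))) _ _))

ones-concat : ∀ {k r} c (css : Vec (Vec Class k) r) (A : Vec (Vec Bool k) r) →
              ones c (concat css) (concat A) ≡ ∑[ i < r ] ones c (lookup css i) (lookup A i)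
ones-concat c [] [] = refl
ones-concat c (cs ∷ css) (bs ∷ A) = trans (ones-++ c cs (concat css) bs (concat A)) (cong (ones c cs bs +_) (ones-concat c css A))

ones-tabulate : ∀ {k} c (f : Fin k → Class) (bs : Vec Bool k) → ones c (Vec.tabulate f) bs ≡ ∑[ j < k ] 𝟙 (lookup bs j ∧ (f j =ᶜ c))
ones-tabulate c f [] = refl
ones-tabulate c f (b ∷ bs) = cong (𝟙 (b ∧ (f zero =ᶜ c)) +_) (ones-tabulate c (f ∘ suc) bs)

size-total : ∀ {K} (cs : Vec Class K) → size loop cs + size incident cs + size other cs ≡ K
size-total [] = refl
size-total (loop ∷ cs) = cong suc (size-total cs)
size-total (incident ∷ cs) = trans (cong (_+ size other cs) (+-suc (size loop cs) (size incident cs))) (cong suc (size-total cs))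
size-total (other ∷ cs) = trans (+-suc (size loop cs + size incident cs) (size other cs)) (cong suc (size-total cs))

hasProfile : ∀ {K} → Vec Class K → ℕ → ℕ → ℕ → Vec Bool K → Bool
hasProfile cs a b e bs = (ones loop cs bs ≡ᵇ a) ∧ (ones incident cs bs ≡ᵇ b) ∧ (ones other cs bs ≡ᵇ e)

countB-hasProfile : ∀ {K} (cs : Vec Class K) a b e →
                    countB (hasProfile cs a b e) (allVec bools K) ≡ (size loop cs C a) * (size incident cs C b) * (size other cs C e)
countB-hasProfile [] zero zero zero = refl
countB-hasProfile [] zero zero (suc e) = refl
countB-hasProfile [] zero (suc b) e = refl
countB-hasProfile [] (suc a) b e = refl
countB-hasProfile {suc K} (c ∷ cs) a b e = begin
  countB Q (W₀ ++ (W₁ ++ []))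
    ≡⟨ countB-++ Q W₀ (W₁ ++ []) ⟩
  countB Q W₀ + countB Q (W₁ ++ [])
    ≡⟨ cong₂ _+_ (countB-map Q (false ∷_) W) (trans (countB-++ Q W₁ []) (trans (+-identityʳ _) (countB-map Q (true ∷_) W))) ⟩
  countB (hasProfile cs a b e) W + countB (Q ∘ (true ∷_)) W
    ≡⟨ by-first-class c a b e ⟩
  (size loop (c ∷ cs) C a) * (size incident (c ∷ cs) C b) * (size other (c ∷ cs) C e) ∎
  where
  open ≡-Reasoning
  Q = hasProfile (c ∷ cs) a b e
  W = allVec bools K
  W₀ W₁ : List (Vec Bool (suc K))
  W₀ = map (false ∷_) W
  W₁ = map (true ∷_) W
  sL = size loop cs
  sI = size incident cs
  sO = size other cs
  by-first-class : ∀ c a b e → countB (hasProfile cs a b e) W + countB (hasProfile (c ∷ cs) a b e ∘ (true ∷_)) W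
                   ≡ (size loop (c ∷ cs) C a) * (size incident (c ∷ cs) C b) * (size other (c ∷ cs) C e)
  by-first-class loop zero b e = trans (cong₂ _+_ (countB-hasProfile cs zero b e) (countB-false W)) (+-identityʳ _)
  by-first-class loop (suc a) b e rewrite countB-hasProfile cs (suc a) b e | countB-hasProfile cs a b e | [1+n]C[1+k]≡nCk+nC[1+k] sL a =
    solve 4 (λ p q r s → q :* r :* s :+ p :* r :* s := (p :+ q) :* r :* s) refl (sL C a) (sL C suc a) (sI C b) (sO C e)
  by-first-class incident a zero e = trans (cong₂ _+_ (countB-hasProfile cs a zero e)
    (trans (countB-cong (λ bs → ∧-zeroʳ (ones loop cs bs ≡ᵇ a)) W) (countB-false W))) (+-identityʳ _)
  by-first-class incident a (suc b) e rewrite countB-hasProfile cs a (suc b) e | countB-hasProfile cs a b e | [1+n]C[1+k]≡nCk+nC[1+k] sI b =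
    solve 4 (λ p q r s → p :* r :* s :+ p :* q :* s := p :* (q :+ r) :* s) refl (sL C a) (sI C b) (sI C suc b) (sO C e)
  by-first-class other a b zero = trans (cong₂ _+_ (countB-hasProfile cs a b zero)
    (trans (countB-cong (λ bs → trans (cong ((ones loop cs bs ≡ᵇ a) ∧_) (∧-zeroʳ _)) (∧-zeroʳ _)) W) (countB-false W))) (+-identityʳ _)
  by-first-class other a b (suc e) rewrite countB-hasProfile cs a b (suc e) | countB-hasProfile cs a b e | [1+n]C[1+k]≡nCk+nC[1+k] sO e =
    solve 4 (λ p q r s → p :* q :* s :+ p :* q :* r := p :* q :* (r :+ s)) refl (sL C a) (sI C b) (sO C e) (sO C suc e)

𝟙-split : ∀ e c → 𝟙 e ≡ 𝟙 (e ∧ (c =ᶜ loop)) + 𝟙 (e ∧ (c =ᶜ incident)) + 𝟙 (e ∧ (c =ᶜ other))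
𝟙-split false c = refl
𝟙-split true loop = refl
𝟙-split true incident = refl
𝟙-split true other = refl

incidentTo : ∀ {n} → Maybe (Fin n) → Fin n → Fin n → Bool
incidentTo nothing i j = false
incidentTo (just v) i j = does (i ≟ v) ∨ does (j ≟ v)

classOf : ∀ {n} → Maybe (Fin n) → Fin n → Fin n → Class
classOf μ i j = if does (i ≟ j) then loop else (if incidentTo μ i j then incident else other)

classes : ∀ {n} → Maybe (Fin n) → Vec Class (n * n)
classes μ = concat (Vec.tabulate λ i → Vec.tabulate λ j → classOf μ i j)

ones-classes : ∀ {n} c (μ : Maybe (Fin n)) (A : Adj n) →
               ones c (classes μ) (concat A) ≡ ∑[ i < n ] ∑[ j < n ] 𝟙 (edge A i j ∧ (classOf μ i j =ᶜ c))
ones-classes {n} c μ A = trans (ones-concat c rows A) (sum-cong-≗ (λ i →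
  trans (cong (λ r → ones c r (lookup A i)) (lookup∘tabulate (λ i → Vec.tabulate (classOf μ i)) i))
        (ones-tabulate c (classOf μ i) (lookup A i))))
  where rows = Vec.tabulate λ i → Vec.tabulate λ j → classOf μ i j

𝟙-loop : ∀ {n} (μ : Maybe (Fin n)) i j e → 𝟙 (e ∧ (classOf μ i j =ᶜ loop)) ≡ (if does (j ≟ i) then 𝟙 e else 0)
𝟙-loop μ i j e with i ≟ j | j ≟ i
... | yes _   | yes _   = cong 𝟙 (∧-identityʳ e)
... | yes i≡j | no j≢i  = ⊥-elim (j≢i (sym i≡j))
... | no i≢j  | yes j≡i = ⊥-elim (i≢j (sym j≡i))
... | no _    | no _ with incidentTo μ i j
...   | true  = cong 𝟙 (∧-zeroʳ e)
...   | false = cong 𝟙 (∧-zeroʳ e)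

𝟙-incident-nothing : ∀ {n} (i j : Fin n) e → 𝟙 (e ∧ (classOf nothing i j =ᶜ incident)) ≡ 0
𝟙-incident-nothing i j e with i ≟ j
... | yes _ = cong 𝟙 (∧-zeroʳ e)
... | no _  = cong 𝟙 (∧-zeroʳ e)

𝟙-incident : ∀ {n} (v i j : Fin n) e →
             𝟙 (e ∧ (classOf (just v) i j =ᶜ incident)) + (if does (i ≟ v) then (if does (j ≟ v) then 2 * 𝟙 e else 0) else 0)
             ≡ (if does (i ≟ v) then 𝟙 e else 0) + (if does (j ≟ v) then 𝟙 e else 0)
𝟙-incident v i j e with i ≟ j | i ≟ v | j ≟ v
... | yes _   | yes _   | yes _   = trans (cong (λ b → 𝟙 b + 2 * 𝟙 e) (∧-zeroʳ e)) (cong (𝟙 e +_) (+-identityʳ (𝟙 e)))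
... | yes i≡j | yes i≡v | no j≢v  = ⊥-elim (j≢v (trans (sym i≡j) i≡v))
... | yes i≡j | no i≢v  | yes j≡v = ⊥-elim (i≢v (trans i≡j j≡v))
... | yes _   | no _    | no _    = cong (λ b → 𝟙 b + 0) (∧-zeroʳ e)
... | no i≢j  | yes i≡v | yes j≡v = ⊥-elim (i≢j (trans i≡v (sym j≡v)))
... | no _    | yes _   | no _    = cong (λ b → 𝟙 b + 0) (∧-identityʳ e)
... | no _    | no _    | yes _   = trans (+-identityʳ _) (cong 𝟙 (∧-identityʳ e))
... | no _    | no _    | no _    = cong (λ b → 𝟙 b + 0) (∧-zeroʳ e)

module _ {n : ℕ} (A : Adj n) where

  ones-loop : ∀ μ → ones loop (classes μ) (concat A) ≡ ∑[ i < n ] 𝟙 (edge A i i)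
  ones-loop μ = trans (ones-classes loop μ A) (sum-cong-≗ λ i →
    trans (sum-cong-≗ λ j → 𝟙-loop μ i j (edge A i j)) (∑-δ i (λ j → 𝟙 (edge A i j))))

  ones-incident-nothing : ones incident (classes {n} nothing) (concat A) ≡ 0
  ones-incident-nothing = trans (ones-classes incident nothing A)
    (trans (sum-cong-≗ {n} λ i → trans (sum-cong-≗ {n} λ j → 𝟙-incident-nothing i j (edge A i j)) (sum-replicate-zero n))
           (sum-replicate-zero n))

  numEdges≡ones : ∀ μ → numEdges A ≡ ones loop (classes μ) (concat A) + ones incident (classes μ) (concat A) + ones other (classes μ) (concat A)
  numEdges≡ones μ = begin
    numEdges A
      ≡⟨ sum-map-tabulate (λ i → countB (edge A i) (allFin n)) (λ i → i) ⟩
    ∑[ i < n ] countB (edge A i) (allFin n)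
      ≡⟨ sum-cong-≗ (λ i → countB-tabulate (edge A i) (λ j → j)) ⟩
    ∑[ i < n ] ∑[ j < n ] 𝟙 (edge A i j)
      ≡⟨ sum-cong-≗ (λ i → sum-cong-≗ λ j → 𝟙-split (edge A i j) (classOf μ i j)) ⟩
    ∑[ i < n ] ∑[ j < n ] (part loop i j + part incident i j + part other i j)
      ≡⟨ ∑²-distrib-+ (λ i j → part loop i j + part incident i j) (part other) ⟩
    ∑[ i < n ] ∑[ j < n ] (part loop i j + part incident i j) + ∑[ i < n ] ∑[ j < n ] part other i j
      ≡⟨ cong (_+ ∑[ i < n ] ∑[ j < n ] part other i j) (∑²-distrib-+ (part loop) (part incident)) ⟩
    ∑[ i < n ] ∑[ j < n ] part loop i j + ∑[ i < n ] ∑[ j < n ] part incident i j + ∑[ i < n ] ∑[ j < n ] part other i j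
      ≡⟨ cong₂ _+_ (cong₂ _+_ (ones-classes loop μ A) (ones-classes incident μ A)) (ones-classes other μ A) ⟨
    ones loop (classes μ) (concat A) + ones incident (classes μ) (concat A) + ones other (classes μ) (concat A) ∎
    where open ≡-Reasoning
          part : Class → Fin n → Fin n → ℕ
          part c i j = 𝟙 (edge A i j ∧ (classOf μ i j =ᶜ c))

  ones-incident+2*loop≡deg : ∀ v → ones incident (classes (just v)) (concat A) + 2 * 𝟙 (edge A v v) ≡ deg A v
  ones-incident+2*loop≡deg v = begin
    ones incident (classes (just v)) (concat A) + 2 * e v v
      ≡⟨ cong₂ _+_ (ones-classes incident (just v) A) (sym loop-sum) ⟩
    ∑[ i < n ] ∑[ j < n ] s i j + ∑[ i < n ] ∑[ j < n ] d i j
      ≡⟨ ∑²-distrib-+ s d ⟨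
    ∑[ i < n ] ∑[ j < n ] (s i j + d i j)
      ≡⟨ sum-cong-≗ (λ i → sum-cong-≗ λ j → 𝟙-incident v i j (edge A i j)) ⟩
    ∑[ i < n ] ∑[ j < n ] (out i j + in′ i j)
      ≡⟨ ∑²-distrib-+ out in′ ⟩
    ∑[ i < n ] ∑[ j < n ] out i j + ∑[ i < n ] ∑[ j < n ] in′ i j
      ≡⟨ cong₂ _+_ out-sum in-sum ⟩
    ∑[ j < n ] e v j + ∑[ i < n ] e i v
      ≡⟨ cong₂ _+_ (countB-tabulate (edge A v) (λ j → j)) (countB-tabulate (λ i → edge A i v) (λ i → i)) ⟨
    deg A v ∎
    where
    open ≡-Reasoning
    e s d out in′ : Fin n → Fin n → ℕ
    e i j = 𝟙 (edge A i j)
    s i j = 𝟙 (edge A i j ∧ (classOf (just v) i j =ᶜ incident))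
    d i j = if does (i ≟ v) then (if does (j ≟ v) then 2 * e i j else 0) else 0
    out i j = if does (i ≟ v) then e i j else 0
    in′ i j = if does (j ≟ v) then e i j else 0
    loop-sum : ∑[ i < n ] ∑[ j < n ] d i j ≡ 2 * e v v
    loop-sum = trans (sum-cong-≗ {n} λ i → trans (∑-if (does (i ≟ v)) (λ j → if does (j ≟ v) then 2 * e i j else 0)) (cong (λ x → if does (i ≟ v) then x else 0) (∑-δ v (λ j → 2 * e i j))))
                     (∑-δ v (λ i → 2 * e i v))
    out-sum : ∑[ i < n ] ∑[ j < n ] out i j ≡ ∑[ j < n ] e v j
    out-sum = trans (sum-cong-≗ λ i → ∑-if (does (i ≟ v)) (e i)) (∑-δ v (λ i → ∑[ j < n ] e i j))
    in-sum : ∑[ i < n ] ∑[ j < n ] in′ i j ≡ ∑[ i < n ] e i v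
    in-sum = sum-cong-≗ λ i → ∑-δ v (e i)

complete : ∀ n → Adj n
complete n = replicate n (replicate n true)

edge-complete : ∀ {n} (i j : Fin n) → edge (complete n) i j ≡ true
edge-complete {n} i j = trans (cong (λ row → lookup row j) (lookup-replicate i (replicate n true))) (lookup-replicate j true)

size≡ones-complete : ∀ {n} c (μ : Maybe (Fin n)) → size c (classes μ) ≡ ones c (classes μ) (concat (complete n))
size≡ones-complete {n} c μ = cong (ones c (classes μ)) (sym (concat-replicate n n true))

size-loop : ∀ {n} (μ : Maybe (Fin n)) → size loop (classes μ) ≡ n
size-loop {n} μ = begin
  size loop (classes μ)                  ≡⟨ size≡ones-complete loop μ ⟩
  ones loop (classes μ) (concat K)       ≡⟨ ones-loop K μ ⟩
  ∑[ i < n ] 𝟙 (edge K i i)              ≡⟨ sum-cong-≗ {n} (λ i → cong 𝟙 (edge-complete i i)) ⟩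
  ∑[ i < n ] 1                           ≡⟨ ∑-const n 1 ⟩
  n * 1                                  ≡⟨ *-identityʳ n ⟩
  n                                      ∎
  where open ≡-Reasoning
        K = complete n

size-incident-nothing : ∀ n → size incident (classes {n} nothing) ≡ 0
size-incident-nothing n = trans (size≡ones-complete incident (nothing {A = Fin n})) (ones-incident-nothing (complete n))

size-incident-just : ∀ {n} (v : Fin n) → size incident (classes (just v)) ≡ 2 * (n ∸ 1)
size-incident-just {n@(suc n′)} v = +-cancelʳ-≡ 2 _ _ (begin
  size incident (classes (just v)) + 2                              ≡⟨ cong₂ _+_ (sym (size≡ones-complete incident (just v))) (cong (λ b → 2 * 𝟙 b) (edge-complete v v)) ⟨
  ones incident (classes (just v)) (concat K) + 2 * 𝟙 (edge K v v)  ≡⟨ ones-incident+2*loop≡deg K v ⟩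
  deg K v                                                           ≡⟨ cong₂ _+_ (countB-tabulate (edge K v) (λ j → j)) (countB-tabulate (λ i → edge K i v) (λ i → i)) ⟩
  ∑[ j < n ] 𝟙 (edge K v j) + ∑[ i < n ] 𝟙 (edge K i v)             ≡⟨ cong₂ _+_ (all-ones (edge-complete v)) (all-ones (λ i → edge-complete i v)) ⟩
  n + n                                                             ≡⟨ solve 1 (λ k → (con 1 :+ k) :+ (con 1 :+ k) := con 2 :* k :+ con 2) refl n′ ⟩
  2 * n′ + 2                                                        ∎)
  where
  open ≡-Reasoning
  K = complete n
  all-ones : ∀ {f : Fin n → Bool} → (∀ i → f i ≡ true) → ∑[ i < n ] 𝟙 (f i) ≡ n
  all-ones f≡true = trans (sum-cong-≗ {n} (λ i → cong 𝟙 (f≡true i))) (trans (∑-const n 1) (*-identityʳ n))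

size-incident+other : ∀ {n} (μ : Maybe (Fin n)) → size incident (classes μ) + size other (classes μ) ≡ n * (n ∸ 1)
size-incident+other {zero} μ = refl
size-incident+other {n@(suc n′)} μ = +-cancelˡ-≡ n _ _ (begin
  n + (I + R)                     ≡⟨ +-assoc n I R ⟨
  n + I + R                       ≡⟨ cong (λ a → a + I + R) (size-loop μ) ⟨
  size loop (classes μ) + I + R   ≡⟨ size-total (classes μ) ⟩
  n * n                           ≡⟨ *-suc n n′ ⟩
  n + n * n′                      ∎)
  where
  open ≡-Reasoning
  I = size incident (classes μ)
  R = size other (classes μ)

noLoops≡ones-loop≡ᵇ0 : ∀ {n} (μ : Maybe (Fin n)) (A : Adj n) → noLoops A ≡ (ones loop (classes μ) (concat A) ≡ᵇ 0)
noLoops≡ones-loop≡ᵇ0 {n} μ A = trans (and-map-not (λ i → edge A i i) (allFin n))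
  (cong (_≡ᵇ 0) (trans (countB-tabulate (λ i → edge A i i) (λ i → i)) (sym (ones-loop A μ))))

isDigraph : ∀ {n} → ℕ → Adj n → Bool
isDigraph m A = noLoops A ∧ (numEdges A ≡ᵇ m)

isDigraph≡hasProfile : ∀ {n} m (A : Adj n) → isDigraph m A ≡ hasProfile (classes {n} nothing) 0 0 m (concat A)
isDigraph≡hasProfile {n} m A = begin
  noLoops A ∧ (numEdges A ≡ᵇ m)               ≡⟨ cong₂ (λ a b → a ∧ (b ≡ᵇ m)) (noLoops≡ones-loop≡ᵇ0 nothing A) (numEdges≡ones A nothing) ⟩
  (L ≡ᵇ 0) ∧ (L + I + R ≡ᵇ m)                 ≡⟨ cong (λ i → (L ≡ᵇ 0) ∧ (L + i + R ≡ᵇ m)) (ones-incident-nothing A) ⟩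
  (L ≡ᵇ 0) ∧ (L + 0 + R ≡ᵇ m)                 ≡⟨ no-incident L ⟩
  (L ≡ᵇ 0) ∧ (0 ≡ᵇ 0) ∧ (R ≡ᵇ m)               ≡⟨ cong (λ i → (L ≡ᵇ 0) ∧ (i ≡ᵇ 0) ∧ (R ≡ᵇ m)) (ones-incident-nothing A) ⟨
  (L ≡ᵇ 0) ∧ (I ≡ᵇ 0) ∧ (R ≡ᵇ m)               ∎
  where
  open ≡-Reasoning
  L = ones loop (classes {n} nothing) (concat A)
  I = ones incident (classes {n} nothing) (concat A)
  R = ones other (classes {n} nothing) (concat A)
  no-incident : ∀ L → (L ≡ᵇ 0) ∧ (L + 0 + R ≡ᵇ m) ≡ (L ≡ᵇ 0) ∧ (0 ≡ᵇ 0) ∧ (R ≡ᵇ m)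
  no-incident zero = refl
  no-incident (suc L) = refl

length-Digraphs : ∀ n m → length (Digraphs n m) ≡ (n * (n ∸ 1)) C m
length-Digraphs n m = begin
  length (Digraphs n m)                                               ≡⟨ length-filterᵇ (isDigraph m) (allAdj n) ⟩
  countB (isDigraph m) (allAdj n)                                     ≡⟨ countB-cong (isDigraph≡hasProfile m) (allAdj n) ⟩
  countB (hasProfile (classes {n} nothing) 0 0 m ∘ concat) (allAdj n)     ≡⟨ countB-concat bools n n (hasProfile (classes {n} nothing) 0 0 m) ⟩
  countB (hasProfile (classes {n} nothing) 0 0 m) (allVec bools (n * n))  ≡⟨ countB-hasProfile (classes {n} nothing) 0 0 m ⟩
  1 * 1 * (size other (classes {n} nothing) C m)                      ≡⟨ *-identityˡ _ ⟩
  size other (classes {n} nothing) C m                                ≡⟨ cong (_C m) non-loops ⟩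
  (n * (n ∸ 1)) C m                                                   ∎
  where
  open ≡-Reasoning
  non-loops : size other (classes {n} nothing) ≡ n * (n ∸ 1)
  non-loops = trans (cong (_+ size other (classes {n} nothing)) (sym (size-incident-nothing n))) (size-incident+other {n} nothing)

isDigraph⇒degree-profile : ∀ {n} m (A : Adj n) v → T (isDigraph m A) →
  deg A v ≤ m × T (hasProfile (classes (just v)) 0 (deg A v) (m ∸ deg A v) (concat A))
isDigraph⇒degree-profile m A v digraph = deg≤m , Equivalence.from T-∧ (≡⇒≡ᵇ L 0 L≡0 ,
  Equivalence.from T-∧ (≡⇒≡ᵇ I (deg A v) (sym deg≡I) , ≡⇒≡ᵇ R (m ∸ deg A v) (sym m∸deg≡R)))
  where
  L = ones loop (classes (just v)) (concat A)
  I = ones incident (classes (just v)) (concat A)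
  R = ones other (classes (just v)) (concat A)
  loopless : T (noLoops A)
  loopless = proj₁ (Equivalence.to T-∧ digraph)
  L≡0 : L ≡ 0
  L≡0 = ≡ᵇ⇒≡ L 0 (subst T (noLoops≡ones-loop≡ᵇ0 (just v) A) loopless)
  I+R≡m : I + R ≡ m
  I+R≡m = trans (cong (λ l → l + I + R) (sym L≡0))
                (trans (sym (numEdges≡ones A (just v))) (≡ᵇ⇒≡ _ m (proj₂ (Equivalence.to T-∧ digraph))))
  no-loop-at-v : 𝟙 (edge A v v) ≡ 0
  no-loop-at-v = n≤0⇒n≡0 (≤-trans (term≤∑ (λ i → 𝟙 (edge A i i)) v) (≤-reflexive (trans (sym (ones-loop A (just v))) L≡0)))
  deg≡I : deg A v ≡ I
  deg≡I = trans (sym (ones-incident+2*loop≡deg A v)) (trans (cong (λ x → I + 2 * x) no-loop-at-v) (+-identityʳ I))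
  deg≤m : deg A v ≤ m
  deg≤m = subst₂ _≤_ (sym deg≡I) I+R≡m (m≤m+n I R)
  m∸deg≡R : m ∸ deg A v ≡ R
  m∸deg≡R = trans (cong₂ _∸_ (sym I+R≡m) deg≡I) (m+n∸m≡n I R)

countB-degree≤ : ∀ {n} m (bad : ℕ → Bool) (v : Fin n) →
  countB (λ A → isDigraph m A ∧ bad (deg A v)) (allAdj n)
  ≤ ∑[ k < suc m ] (𝟙 (bad (toℕ k)) * ((size incident (classes (just v)) C toℕ k) * (size other (classes (just v)) C (m ∸ toℕ k))))
countB-degree≤ {n} m bad v = begin
  countB (λ A → isDigraph m A ∧ bad (deg A v)) (allAdj n)
    ≤⟨ countB-≤-∑ _ (λ k A → bad (toℕ k) ∧ profile (toℕ k) (concat A)) witness (allAdj n) ⟩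
  ∑[ k < suc m ] countB (λ A → bad (toℕ k) ∧ profile (toℕ k) (concat A)) (allAdj n)
    ≡⟨ sum-cong-≗ {suc m} (λ k → countB-∧ˡ (bad (toℕ k)) (profile (toℕ k) ∘ concat) (allAdj n)) ⟩
  ∑[ k < suc m ] (𝟙 (bad (toℕ k)) * countB (profile (toℕ k) ∘ concat) (allAdj n))
    ≡⟨ sum-cong-≗ {suc m} (λ k → cong (𝟙 (bad (toℕ k)) *_) (trans (countB-concat bools n n (profile (toℕ k)))
         (trans (countB-hasProfile cs 0 (toℕ k) (m ∸ toℕ k)) (cong (_* (size other cs C (m ∸ toℕ k))) (*-identityˡ (size incident cs C toℕ k)))))) ⟩
  ∑[ k < suc m ] (𝟙 (bad (toℕ k)) * ((size incident cs C toℕ k) * (size other cs C (m ∸ toℕ k)))) ∎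
  where
  open ≤-Reasoning
  cs = classes (just v)
  profile : ℕ → Vec Bool (n * n) → Bool
  profile k = hasProfile cs 0 k (m ∸ k)
  witness : ∀ A → T (isDigraph m A ∧ bad (deg A v)) → ∃[ k ] T (bad (toℕ k) ∧ profile (toℕ k) (concat A))
  witness A h with Equivalence.to T-∧ h
  ... | digraph , bad-deg with isDigraph⇒degree-profile m A v digraph
  ...   | deg≤m , has-profile = fromℕ< (s≤s deg≤m) ,
          subst (λ k → T (bad k ∧ profile k (concat A))) (sym (toℕ-fromℕ< (s≤s deg≤m))) (Equivalence.from T-∧ (bad-deg , has-profile))

-- u k / w k = (2m/n)^k / k! · C(n(n−1), m) bounds the number of digraphs in which v has degree k.
vertex-tail-bound : ∀ n m .{{_ : NonZero n}} → 2 ≤ n → (v : Fin n) →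
  n * n * (3 * countB (λ A → isDigraph m A ∧ tooLarge n m (deg A v)) (allAdj n)) ≤ 4 * ((n * (n ∸ 1)) C m)
vertex-tail-bound n m 2≤n v = ≤-trans (*-monoʳ-≤ (n * n) (*-monoʳ-≤ 3 (countB-degree≤ m (tooLarge n m) v)))
  (upward-closed-tail 3 (n * n) (N C m) (tooLarge n m) (suc m) x u w (tooLarge-suc n m) w>0 xw≤u ratio n²u≤w*total)
  where
  N = n * (n ∸ 1)
  I = size incident (classes (just v))
  R = size other (classes (just v))
  x u w : ℕ → ℕ
  x k = (I C k) * (R C (m ∸ k))
  u k = (2 * m) ^ k * (N C m)
  w k = k ! * n ^ k
  w>0 : ∀ k → 0 < w k
  w>0 k = *-mono-≤ (1≤n! k) (m^n>0 n k)
  In≤2[I+R] : I * n ≤ 2 * (I + R)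
  In≤2[I+R] = ≤-reflexive (begin-equality
    I * n                ≡⟨ cong (_* n) (size-incident-just v) ⟩
    2 * (n ∸ 1) * n      ≡⟨ solve 2 (λ a b → con 2 :* a :* b := con 2 :* (b :* a)) refl (n ∸ 1) n ⟩
    2 * (n * (n ∸ 1))    ≡⟨ cong (2 *_) (size-incident+other (just v)) ⟨
    2 * (I + R)          ∎)
    where open ≤-Reasoning
  xw≤u : ∀ k → k < suc m → x k * w k ≤ u k
  xw≤u k k<1+m = subst₂ _≤_ (solve 4 (λ a b f p → a :* b :* f :* p := a :* b :* (f :* p)) refl (I C k) (R C (m ∸ k)) (k !) (n ^ k))
                            (cong (λ t → (2 * m) ^ k * (t C m)) (size-incident+other (just v)))
                            (hypergeometric-bound 2 I R m k 2≤n In≤2[I+R] (s≤s⁻¹ k<1+m))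
  ratio : ∀ k → T (tooLarge n m k) → 4 * u (suc k) * w k ≤ u k * w (suc k)
  ratio k large = [2m/n]^k/k!-ratio n m k (N C m) (≤-trans (<⇒≤ (proj₁ (tooLarge⇒ {n} {m} {k} large))) (m≤n+m (k * n) n))
  n²u≤w*total : ∀ k → T (tooLarge n m k) → n * n * u k ≤ w k * (N C m)
  n²u≤w*total k large with tooLarge⇒ {n} {m} {k} large
  ... | 8m<kn , gap = subst (_≤ w k * (N C m)) (*-assoc (n * n) ((2 * m) ^ k) (N C m))
                        (*-monoˡ-≤ (N C m) (n*n*[2m]^k≤k!*n^k n m k (<⇒≤ 8m<kn) (<⇒≤ gap)))

length-Bad≤∑ : ∀ n m → length (filterᵇ (Bad n m) (Digraphs n m))
               ≤ ∑[ v < n ] countB (λ A → isDigraph m A ∧ tooLarge n m (deg A v)) (allAdj n)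
length-Bad≤∑ n m = begin
  length (filterᵇ (Bad n m) (Digraphs n m))                ≡⟨ length-filterᵇ (Bad n m) (Digraphs n m) ⟩
  countB (Bad n m) (filterᵇ (isDigraph m) (allAdj n))      ≡⟨ countB-filterᵇ (isDigraph m) (Bad n m) (allAdj n) ⟩
  countB (λ A → isDigraph m A ∧ Bad n m A) (allAdj n)      ≤⟨ countB-≤-∑ _ _ witness (allAdj n) ⟩
  ∑[ v < n ] countB (λ A → isDigraph m A ∧ tooLarge n m (deg A v)) (allAdj n) ∎
  where
  open ≤-Reasoning
  witness : ∀ A → T (isDigraph m A ∧ Bad n m A) → ∃[ v ] T (isDigraph m A ∧ tooLarge n m (deg A v))
  witness A h with Equivalence.to T-∧ h
  ... | digraph , bad with satisfied (any⁻ (λ v → tooLarge n m (deg A v)) (allFin n) bad)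
  ...   | v , large = v , Equivalence.from T-∧ (digraph , large)

3*x≤4*y⇒x<2*y : ∀ {x y} → 0 < y → 3 * x ≤ 4 * y → x < 2 * y
3*x≤4*y⇒x<2*y {x} {y} y>0 3x≤4y with x <? 2 * y
... | yes x<2y = x<2y
... | no x≮2y = ⊥-elim (<⇒≱ (begin-strict
  4 * y             <⟨ m<m+n (4 * y) (*-monoʳ-< 2 y>0) ⟩
  4 * y + 2 * y     ≡⟨ solve 1 (λ y → con 4 :* y :+ con 2 :* y := con 3 :* (con 2 :* y)) refl y ⟩
  3 * (2 * y)       ≤⟨ *-monoʳ-≤ 3 (≮⇒≥ x≮2y) ⟩
  3 * x             ∎) 3x≤4y)
  where open ≤-Reasoning

lemma1 : (n m : ℕ) → 2 ≤ n → m ≤ n * (n ∸ 1) →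
    length (filterᵇ (Bad n m) (Digraphs n m)) * n < 2 * length (Digraphs n m)
lemma1 n@(suc _) m 2≤n m≤N = subst (λ t → bad * n < 2 * t) (sym (length-Digraphs n m))
  (3*x≤4*y⇒x<2*y (nCk>0 m≤N) (*-cancelˡ-≤ n (begin
    n * (3 * (bad * n))                  ≡⟨ solve 2 (λ n b → n :* (con 3 :* (b :* n)) := n :* n :* (con 3 :* b)) refl n bad ⟩
    n * n * (3 * bad)                    ≤⟨ *-monoʳ-≤ (n * n) (*-monoʳ-≤ 3 (length-Bad≤∑ n m)) ⟩
    n * n * (3 * ∑[ v < n ] count v)     ≡⟨ cong (n * n *_) (*-distribˡ-sum 3 count) ⟩
    n * n * ∑[ v < n ] (3 * count v)     ≡⟨ *-distribˡ-sum (n * n) (λ v → 3 * count v) ⟩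
    ∑[ v < n ] (n * n * (3 * count v))   ≤⟨ ∑-mono-≤ (vertex-tail-bound n m 2≤n) ⟩
    ∑[ v < n ] (4 * total)               ≡⟨ ∑-const n (4 * total) ⟩
    n * (4 * total)                      ∎)))
  where
  open ≤-Reasoning
  bad = length (filterᵇ (Bad n m) (Digraphs n m))
  total = (n * (n ∸ 1)) C m
  count : Fin n → ℕ
  count v = countB (λ A → isDigraph m A ∧ tooLarge n m (deg A v)) (allAdj n)
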